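{- For any permutation $p$ of $\mathbb N$, there exists a permutation $g$ of $\mathbb N$ such that $g[n]=p[n]$ for infinitely many $n\in\mathbb N$, and $g[n]=n$ for infinitely many $n\in\mathbb N$.
   Context: Each natural number $n$ is identified with the set $\{0,1,\dots,n-1\}$. For a function $f$ with domain $\mathbb N$, $f[n]=\{f(0),f(1),\dots,f(n-1)\}$ denotes the image of the set $n$. -}

module Defs where

open import Data.Nat using (ℕ; _<_; _≤_)
open import Data.Product using (Σ; ∃; ∃-syntax; _×_)
open import Relation.Binary.PropositionalEquality using (_≡_)
open import Function.Bundles using (_↔_; Inverse; _⇔_)

Perm : Set
Perm = ℕ ↔ ℕ

app : Perm → ℕ → ℕ
app p = Inverse.to p

-- membership in the image f[n] = {f 0, …, f (n-1)}
_∈Img[_]_ : ℕ → (ℕ → ℕ) → ℕ → Set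
x ∈Img[ f ] n = ∃[ i ] (i < n × f i ≡ x)

SameImage : (ℕ → ℕ) → (ℕ → ℕ) → ℕ → Set
SameImage f g n = ∀ x → (x ∈Img[ f ] n) ⇔ (x ∈Img[ g ] n)

-- f[n] = n = {0, …, n-1}
ImageIsInitial : (ℕ → ℕ) → ℕ → Set
ImageIsInitial f n = ∀ x → (x ∈Img[ f ] n) ⇔ (x < n)

InfinitelyMany : (ℕ → Set) → Set
InfinitelyMany P = ∀ m → ∃[ n ] (m ≤ n × P n)

-- For a permutation p of ℕ we build a permutation g of ℕ as the limit of a
-- chain of finite injective sequences ("stages") h₀ ⊑ h₁ ⊑ h₂ ⊑ …, each a
-- proper extension of the previous one.  Stage k+1 is obtained from stage k
-- by aiming at the target permutation T = p for even k and T = id for odd k: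
-- if stage k has length m and N is large enough that h_k[m] ⊆ T[N], we append
-- N - m values, each time a value T i with i ≤ (current length) that is not
-- yet used.  Pigeonhole guarantees such a value exists and, once length N is
-- reached, that the image is exactly T[N].  Hence g[N] = p[N] and g[N] = N
-- each happen along infinitely many stage lengths N; the second property also
-- makes g surjective, and injectivity of g is inherited from the stages.
module Submission where

open import Defs
open import Data.Product using (∃-syntax; _×_; _,_; proj₁; proj₂)
open import Data.Nat using (ℕ; zero; suc; _+_; _<_; _≤_; _≟_; z≤n; s≤s)
open import Data.Nat.Properties
open import Data.Fin using (Fin; toℕ; fromℕ<)
open import Data.Fin.Properties using (injective⇒≤; toℕ-injective; toℕ<n; toℕ-fromℕ<)
open import Data.Empty using (⊥-elim)
open import Data.Sum using (inj₁; inj₂)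
open import Relation.Nullary using (Dec; yes; no; ¬_; ¬?)
open import Relation.Nullary.Decidable using (decidable-stable)
open import Relation.Binary.PropositionalEquality
open import Function.Bundles using (Inverse; Injection; Equivalence; mk↔ₛ′; mk⇔)
open import Function.Construct.Composition using (_⇔-∘_)
open import Function.Construct.Identity using (↔-id)
open import Function.Properties.Inverse using (↔⇒↣)

app-injective : (T : Perm) → ∀ {i j} → app T i ≡ app T j → i ≡ j
app-injective T = Injection.injective (↔⇒↣ T)

InjectiveOn : (ℕ → ℕ) → ℕ → Set
InjectiveOn f n = ∀ {i j} → i < n → j < n → f i ≡ f j → i ≡ j

ImageWithin : (ℕ → ℕ) → ℕ → (ℕ → ℕ) → ℕ → Set
ImageWithin f a g b = ∀ j → j < a → f j ∈Img[ g ] b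

_∈Img?[_]_ : ∀ x f n → Dec (x ∈Img[ f ] n)
x ∈Img?[ f ] n = anyUpTo? (λ i → f i ≟ x) n

-- Pigeonhole: if f is injective on a and f[a] ⊆ g[b], then a ≤ b, because
-- the g-positions of the values f j form an injection from Fin a to Fin b.
pigeonhole : ∀ {f g a b} → InjectiveOn f a → ImageWithin f a g b → a ≤ b
pigeonhole {f} {g} {a} {b} f-inj f⊆g = injective⇒≤ position-injective
  where
  position : Fin a → ℕ
  position j = proj₁ (f⊆g (toℕ j) (toℕ<n j))

  position< : ∀ j → position j < b
  position< j = proj₁ (proj₂ (f⊆g (toℕ j) (toℕ<n j)))

  hits : ∀ j → g (position j) ≡ f (toℕ j)
  hits j = proj₂ (proj₂ (f⊆g (toℕ j) (toℕ<n j)))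

  position-injective : ∀ {x y} → fromℕ< (position< x) ≡ fromℕ< (position< y) → x ≡ y
  position-injective {x} {y} e = toℕ-injective (f-inj (toℕ<n x) (toℕ<n y) (begin
    f (toℕ x)       ≡⟨ sym (hits x) ⟩
    g (position x)  ≡⟨ cong g same-position ⟩
    g (position y)  ≡⟨ hits y ⟩
    f (toℕ y)       ∎))
    where
    open ≡-Reasoning
    same-position : position x ≡ position y
    same-position = trans (sym (toℕ-fromℕ< (position< x)))
                          (trans (cong toℕ e) (toℕ-fromℕ< (position< y)))

agree⇒sameImage : ∀ {f g n} → (∀ j → j < n → f j ≡ g j) → SameImage f g n
agree⇒sameImage f≡g x = mk⇔
  (λ { (j , j< , e) → j , j< , trans (sym (f≡g j j<)) e })
  (λ { (j , j< , e) → j , j< , trans (f≡g j j<) e })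

sameImage-id⇒initial : ∀ {f n} → SameImage f (λ x → x) n → ImageIsInitial f n
sameImage-id⇒initial {f} {n} same x = mk⇔
  (λ mem → below (Equivalence.to (same x) mem))
  (λ x<n → Equivalence.from (same x) (x , x<n , refl))
  where
  below : x ∈Img[ (λ y → y) ] n → x < n
  below (j , j<n , refl) = j<n

extend : (ℕ → ℕ) → ℕ → ℕ → ℕ → ℕ
extend h n v j with j ≟ n
... | yes _ = v
... | no _ = h j

extend-below : ∀ h n v j → j < n → extend h n v j ≡ h j
extend-below h n v j j<n with j ≟ n
... | yes refl = ⊥-elim (<-irrefl refl j<n)
... | no _ = refl

extend-at : ∀ h n v → extend h n v n ≡ v
extend-at h n v with n ≟ n
... | yes _ = refl
... | no n≢n = ⊥-elim (n≢n refl)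

extend-preserves : ∀ (P : ℕ → Set) {h n v} → P v → (∀ j → j < n → P (h j)) →
                   ∀ j → j < suc n → P (extend h n v j)
extend-preserves P {h} {n} {v} Pv Ph j j< with m<1+n⇒m<n∨m≡n j<
... | inj₁ j<n = subst P (sym (extend-below h n v j j<n)) (Ph j j<n)
... | inj₂ refl = subst P (sym (extend-at h n v)) Pv

extend-injective : ∀ {h n v} → InjectiveOn h n → ¬ (v ∈Img[ h ] n) → InjectiveOn (extend h n v) (suc n)
extend-injective {h} {n} {v} h-inj fresh {i} {j} i< j< e
  with m<1+n⇒m<n∨m≡n i< | m<1+n⇒m<n∨m≡n j<
... | inj₁ i<n | inj₁ j<n = h-inj i<n j<n (trans (sym (extend-below h n v i i<n)) (trans e (extend-below h n v j j<n)))
... | inj₁ i<n | inj₂ refl = ⊥-elim (fresh (i , i<n , trans (sym (extend-below h n v i i<n)) (trans e (extend-at h n v))))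
... | inj₂ refl | inj₁ j<n = ⊥-elim (fresh (j , j<n , trans (sym (extend-below h n v j j<n)) (trans (sym e) (extend-at h n v))))
... | inj₂ refl | inj₂ refl = refl

-- For injective g, the n values of h cannot cover g 0, …, g n, so some
-- g i with i ≤ n is not yet in h[n] (found by bounded search).
unusedValue : ∀ {g} → (∀ {i j} → g i ≡ g j → i ≡ j) →
              ∀ h n → ∃[ i ] (i < suc n × ¬ (g i ∈Img[ h ] n))
unusedValue {g} g-inj h n with anyUpTo? (λ i → ¬? (g i ∈Img?[ h ] n)) (suc n)
... | yes found = found
... | no none = ⊥-elim (1+n≰n (pigeonhole (λ _ _ → g-inj) all-used))
  where
  all-used : ImageWithin g (suc n) h n
  all-used j j< = decidable-stable (g j ∈Img?[ h ] n) (λ unused → none (j , j< , unused))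

-- If h is injective on n and h[n] ⊆ g[n], then h[n] = g[n]: a value g i
-- missing from h[n] could be appended, giving n+1 distinct values in g[n].
fill : ∀ {h g n} → InjectiveOn h n → ImageWithin h n g n → SameImage h g n
fill {h} {g} {n} h-inj h⊆g x = mk⇔ (λ { (j , j< , refl) → h⊆g j j< }) covered
  where
  covered : x ∈Img[ g ] n → x ∈Img[ h ] n
  covered (i , i<n , refl) with g i ∈Img?[ h ] n
  ... | yes used = used
  ... | no unused = ⊥-elim (1+n≰n (pigeonhole (extend-injective h-inj unused)
          (extend-preserves (λ y → y ∈Img[ g ] n) (i , i<n , refl) h⊆g)))

sumBelow : (ℕ → ℕ) → ℕ → ℕ
sumBelow f zero = 0
sumBelow f (suc m) = f m + sumBelow f m

sumBelow-≥ : ∀ f m j → j < m → f j ≤ sumBelow f m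
sumBelow-≥ f (suc m) j j< with m<1+n⇒m<n∨m≡n j<
... | inj₁ j<m = ≤-trans (sumBelow-≥ f m j j<m) (m≤n+m _ (f m))
... | inj₂ refl = m≤m+n (f j) _

record Stage : Set where
  field
    len : ℕ
    seq : ℕ → ℕ
    injective : InjectiveOn seq len
open Stage

module Towards (T : Perm) where

  fresh : (s : Stage) → ∃[ i ] (i < suc (len s) × ¬ (app T i ∈Img[ seq s ] (len s)))
  fresh s = unusedValue (app-injective T) (seq s) (len s)

  grow : Stage → Stage
  grow s = record
    { len = suc (len s)
    ; seq = extend (seq s) (len s) (app T (proj₁ (fresh s)))
    ; injective = extend-injective (injective s) (proj₂ (proj₂ (fresh s)))
    }

  grow-below : ∀ s j → j < len s → seq (grow s) j ≡ seq s j
  grow-below s j = extend-below (seq s) (len s) _ j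

  grow-within : ∀ s N → suc (len s) ≤ N → ImageWithin (seq s) (len s) (app T) N →
                ImageWithin (seq (grow s)) (suc (len s)) (app T) N
  grow-within s N le within = extend-preserves (λ y → y ∈Img[ app T ] N)
    (proj₁ (fresh s) , ≤-trans (proj₁ (proj₂ (fresh s))) le , refl) within

  grows : ℕ → Stage → Stage
  grows zero s = s
  grows (suc l) s = grow (grows l s)

  grows-len : ∀ l s → len (grows l s) ≡ l + len s
  grows-len zero s = refl
  grows-len (suc l) s = cong suc (grows-len l s)

  grows-below : ∀ l s j → j < len s → seq (grows l s) j ≡ seq s j
  grows-below zero s j j< = refl
  grows-below (suc l) s j j< = trans
    (grow-below (grows l s) j (<-≤-trans j< (subst (len s ≤_) (sym (grows-len l s)) (m≤n+m _ l))))
    (grows-below l s j j<)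

  grows-within : ∀ l s N → len (grows l s) ≤ N → ImageWithin (seq s) (len s) (app T) N →
                 ImageWithin (seq (grows l s)) (len (grows l s)) (app T) N
  grows-within zero s N le within = within
  grows-within (suc l) s N le within =
    grow-within (grows l s) N le (grows-within l s N (≤-trans (n≤1+n _) le) within)

  -- Enough steps that every T⁻¹-index of a value of s falls below the final length.
  steps : Stage → ℕ
  steps s = suc (sumBelow (λ j → Inverse.from T (seq s j)) (len s))

  toward : Stage → Stage
  toward s = grows (steps s) s

  toward-longer : ∀ s → len s < len (toward s)
  toward-longer s = subst (len s <_) (sym (grows-len (steps s) s)) (s≤s (m≤n+m _ _))

  toward-below : ∀ s j → j < len s → seq (toward s) j ≡ seq s j
  toward-below s = grows-below (steps s) s

  toward-image : ∀ s → SameImage (seq (toward s)) (app T) (len (toward s))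
  toward-image s = fill (injective (toward s)) (grows-within (steps s) s _ ≤-refl initial)
    where
    initial : ImageWithin (seq s) (len s) (app T) (len (toward s))
    initial j j< = Inverse.from T (seq s j)
      , subst (Inverse.from T (seq s j) <_) (sym (grows-len (steps s) s))
          (s≤s (≤-trans (sumBelow-≥ (λ j → Inverse.from T (seq s j)) (len s) j j<) (m≤m+n _ _)))
      , Inverse.strictlyInverseˡ T (seq s j)

module Limit (chain : ℕ → Stage)
             (longer : ∀ k → len (chain k) < len (chain (suc k)))
             (extends : ∀ k j → j < len (chain k) → seq (chain (suc k)) j ≡ seq (chain k) j) where

  limit : ℕ → ℕ
  limit j = seq (chain (suc j)) j

  len-≥ : ∀ k → k ≤ len (chain k)
  len-≥ zero = z≤n
  len-≥ (suc k) = ≤-trans (s≤s (len-≥ k)) (longer k)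

  len-mono : ∀ d k → len (chain k) ≤ len (chain (d + k))
  len-mono zero k = ≤-refl
  len-mono (suc d) k = ≤-trans (len-mono d k) (<⇒≤ (longer (d + k)))

  stable : ∀ d k j → j < len (chain k) → seq (chain (d + k)) j ≡ seq (chain k) j
  stable zero k j j< = refl
  stable (suc d) k j j< = trans (extends (d + k) j (<-≤-trans j< (len-mono d k))) (stable d k j j<)

  limit-agrees : ∀ k j → j < len (chain k) → limit j ≡ seq (chain k) j
  limit-agrees k j j< = begin
    seq (chain (suc j)) j      ≡⟨ sym (stable k (suc j) j (len-≥ (suc j))) ⟩
    seq (chain (k + suc j)) j  ≡⟨ cong (λ i → seq (chain i) j) (+-comm k (suc j)) ⟩
    seq (chain (suc j + k)) j  ≡⟨ stable (suc j) k j j< ⟩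
    seq (chain k) j            ∎
    where open ≡-Reasoning

  limit-injective : ∀ {i j} → limit i ≡ limit j → i ≡ j
  limit-injective {i} {j} e = injective (chain k) i< j<
      (trans (sym (limit-agrees k i i<)) (trans e (limit-agrees k j j<)))
    where
    k = suc (i + j)
    i< : i < len (chain k)
    i< = ≤-trans (s≤s (m≤m+n i j)) (len-≥ k)
    j< : j < len (chain k)
    j< = ≤-trans (s≤s (m≤n+m j i)) (len-≥ k)

  limit-image : ∀ k → SameImage limit (seq (chain k)) (len (chain k))
  limit-image k = agree⇒sameImage (limit-agrees k)

alternate : {A : Set} → A → A → ℕ → A
alternate a b zero = a
alternate a b (suc k) = alternate b a k

alternate-even : ∀ {A : Set} (a b : A) m → alternate a b (m + m) ≡ a
alternate-even a b zero = refl
alternate-even a b (suc m) = trans (cong (alternate b a) (+-suc m m)) (alternate-even a b m)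

module Construction (p : Perm) where

  target : ℕ → Perm
  target = alternate p (↔-id ℕ)

  empty : Stage
  empty = record { len = 0 ; seq = λ _ → 0 ; injective = λ () }

  chain : ℕ → Stage
  chain zero = empty
  chain (suc k) = Towards.toward (target k) (chain k)

  open Limit chain (λ k → Towards.toward-longer (target k) (chain k))
                   (λ k → Towards.toward-below (target k) (chain k))

  hits-target : ∀ k → SameImage limit (app (target k)) (len (chain (suc k)))
  hits-target k x = Towards.toward-image (target k) (chain k) x ⇔-∘ limit-image (suc k) x

  far : ∀ m k → m + m < k → m ≤ len (chain k)
  far m k lt = ≤-trans (m≤m+n m m) (≤-trans (<⇒≤ lt) (len-≥ k))

  like-p-at : ∀ m → SameImage limit (app p) (len (chain (suc (m + m))))
  like-p-at m = subst (λ T → SameImage limit (app T) (len (chain (suc (m + m)))))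
                      (alternate-even p (↔-id ℕ) m) (hits-target (m + m))

  initial-at : ∀ m → ImageIsInitial limit (len (chain (suc (suc (m + m)))))
  initial-at m = sameImage-id⇒initial
    (subst (λ T → SameImage limit (app T) (len (chain (suc (suc (m + m))))))
           (alternate-even (↔-id ℕ) p m) (hits-target (suc (m + m))))

  infinitely-like-p : InfinitelyMany (λ n → SameImage limit (app p) n)
  infinitely-like-p m = len (chain (suc (m + m))) , far m (suc (m + m)) ≤-refl , like-p-at m

  infinitely-initial : InfinitelyMany (ImageIsInitial limit)
  infinitely-initial m = len (chain (suc (suc (m + m)))) , far m (suc (suc (m + m))) (n≤1+n _) , initial-at m

  -- Every y lies in the initial image of stage 2y+2, so it is a value of the limit.
  limit-surjective : ∀ y → ∃[ j ] (limit j ≡ y)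
  limit-surjective y = proj₁ hit , proj₂ (proj₂ hit)
    where
    y<len : y < len (chain (suc (suc (y + y))))
    y<len = <-≤-trans (s≤s (≤-trans (m≤m+n y y) (n≤1+n _))) (len-≥ _)
    hit : y ∈Img[ limit ] (len (chain (suc (suc (y + y)))))
    hit = Equivalence.from (initial-at y y) y<len

  g : Perm
  g = mk↔ₛ′ limit (λ y → proj₁ (limit-surjective y)) (λ y → proj₂ (limit-surjective y))
            (λ x → limit-injective (proj₂ (limit-surjective (limit x))))

lemma4p2 : (p : Perm) → ∃[ g ] (InfinitelyMany (λ n → SameImage (app g) (app p) n) × InfinitelyMany (λ n → ImageIsInitial (app g) n))
lemma4p2 p = g , infinitely-like-p , infinitely-initial
  where open Construction p
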